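{- Let $n\ge1$ and let $F$ be a facet of ${\cal H}(B(n))$. Then there exist a strict linear order $L$ on $\{1,\dots,n\}$ and a spanning tree $T$ of $K_n$ such that $F=\Phi(L,T,\mathcal O)$, where $\mathcal O$ is the orientation of $T$ opposite to $L$.
   Context: For $n\ge1$, $B(n)$ denotes the aperiodic Brandt semigroup: the set $(\{1,\dots,n\}\times\{1,\dots,n\})\cup\{0\}$, where $0$ is a zero element and $(i,j)(k,l)=(i,l)$ if $j=k$ and $(i,j)(k,l)=0$ otherwise. Its set of idempotents is $E(B(n))=\{0\}\cup\{(i,i)\mid1\le i\le n\}$. For $Y\subseteq B(n)$, $Y^+$ denotes the subsemigroup generated by $Y$ ($\emptyset^+=\emptyset$). The subsemigroup complex ${\cal H}(B(n))$ has vertex set $B(n)$, and a subset $X$ is a face iff it admits an enumeration $x_1,\dots,x_k$ with $\emptyset\subset\{x_1\}^+\subset\cdots\subset\{x_1,\dots,x_k\}^+$ (all inclusions strict); a facet is a maximal face. $K_n$ is the complete undirected graph on $\{1,\dots,n\}$. Given a strict linear order $<_L$ on $\{1,\dots,n\}$ and a spanning tree $T$ of $K_n$, the orientation $\mathcal O$ of $T$ opposite to $L$ is $\mathcal O=\{(p,q)\mid \{p,q\}\in T,\ q<_L p\}$, and $$\Phi(L,T,\mathcal O)=\{0\}\cup\{(i,j)\mid i<_L j\}\cup E(B(n))\cup\mathcal O.$$ -}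

module Defs where

open import Level using (0ℓ)
open import Data.Nat using (ℕ; suc; _<_; _≤_)
open import Data.Fin using (Fin; _≟_)
open import Data.Product using (_×_; Σ; ∃; ∃-syntax; _,_)
open import Data.Sum using (_⊎_)
open import Data.Empty using (⊥)
open import Data.List using (List; []; _∷_; _++_; [_]; take; length)
open import Data.List.Membership.Propositional using (_∈_)
open import Data.List.Relation.Unary.Unique.Propositional using (Unique)
open import Data.List.Relation.Unary.Linked using (Linked)
open import Relation.Nullary using (¬_; yes; no)
open import Relation.Binary using (Rel; IsStrictTotalOrder)
open import Relation.Binary.PropositionalEquality using (_≡_)
open import Relation.Binary.Construct.Closure.ReflexiveTransitive using (Star)
open import Function.Bundles using (_⇔_)

-- The aperiodic Brandt semigroup B(n); indices 1..n are represented by Fin n.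
data B (n : ℕ) : Set where
  𝟘   : B n
  pr  : Fin n → Fin n → B n

_·_ : ∀ {n} → B n → B n → B n
𝟘 · _ = 𝟘
pr _ _ · 𝟘 = 𝟘
pr i j · pr k l with j ≟ k
... | yes _ = pr i l
... | no  _ = 𝟘

Subset : ℕ → Set₁
Subset n = B n → Set

_⊆_ : ∀ {n} → Subset n → Subset n → Set
X ⊆ Y = ∀ x → X x → Y x

_⊂_ : ∀ {n} → Subset n → Subset n → Set
X ⊂ Y = X ⊆ Y × ¬ (Y ⊆ X)

data Gen {n : ℕ} (Y : Subset n) : B n → Set where
  base : ∀ {x} → Y x → Gen Y x
  mul  : ∀ {x y} → Gen Y x → Gen Y y → Gen Y (x · y)

⟦_⟧ : ∀ {n} → List (B n) → Subset n
⟦ xs ⟧ x = x ∈ xs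

-- the enumeration x₁,…,x_k gives a strict chain
-- ∅ ⊂ {x₁}⁺ ⊂ {x₁,x₂}⁺ ⊂ … ⊂ {x₁,…,x_k}⁺ ;  note {x₁,…,x_i}⁺ = Gen ⟦ take i xs ⟧, and ∅⁺ = ∅ = Gen ⟦ [] ⟧
StrictChain : ∀ {n} → List (B n) → Set
StrictChain xs = ∀ i → i < length xs → Gen ⟦ take i xs ⟧ ⊂ Gen ⟦ take (suc i) xs ⟧

IsFace : ∀ {n} → Subset n → Set
IsFace {n} X = Σ (List (B n)) λ xs → Unique xs × (∀ x → X x ⇔ (x ∈ xs)) × StrictChain xs

IsFacet : ∀ {n} → Subset n → Set₁
IsFacet {n} F = IsFace F × (∀ (G : Subset n) → IsFace G → F ⊆ G → G ⊆ F)

IsStrictLinearOrder : ∀ {n} → Rel (Fin n) 0ℓ → Set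
IsStrictLinearOrder L = IsStrictTotalOrder _≡_ L

-- Graphs on the vertex set {1,…,n}: subgraphs of K_n given by their (symmetric, loopless) edge relation.
HasCycle : ∀ {n} → Rel (Fin n) 0ℓ → Set
HasCycle {n} T = Σ (Fin n) λ v₀ → Σ (List (Fin n)) λ rest →
  (2 ≤ length rest) × Unique (v₀ ∷ rest) × Linked T (v₀ ∷ rest ++ [ v₀ ])

IsSpanningTree : ∀ {n} → Rel (Fin n) 0ℓ → Set
IsSpanningTree {n} T =
    (∀ p q → T p q → T q p)
  × (∀ p → ¬ T p p)
  × (∀ p q → Star T p q)
  × ¬ HasCycle T

Opposite : ∀ {n} → Rel (Fin n) 0ℓ → Rel (Fin n) 0ℓ → Rel (Fin n) 0ℓ
Opposite L T p q = T p q × L q p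

E : ∀ {n} → Subset n
E x = (x ≡ 𝟘) ⊎ ∃[ i ] (x ≡ pr i i)

Φ : ∀ {n} → Rel (Fin n) 0ℓ → Rel (Fin n) 0ℓ → Subset n
Φ L O x = (x ≡ 𝟘)
        ⊎ (∃[ i ] ∃[ j ] (x ≡ pr i j × L i j))
        ⊎ E x
        ⊎ (∃[ p ] ∃[ q ] (x ≡ pr p q × O p q))

module Submission where

-- A face is a set with an *independent* enumeration: each element lies outside
-- the subsemigroup generated by its predecessors (equivalent to the strict chain
-- condition).  From such an enumeration of a facet F we build a binary *cut tree*
-- on the vertices: split the vertex set V into parts A, B such that the only pair
-- of F leading from B back to A is one split edge (p,q) (take the last pair of F
-- inside V and let B be all that p reaches through the earlier pairs), and recurse.
-- The in-order traversal gives L, the split edges give the spanning tree T.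
-- The set G = {0} ∪ loops ∪ {(i,j) | i <_L j} ∪ split edges is Φ(L,T,O); it
-- contains F, and it is a face: enumerate 0, the loops, the forward pairs
-- top-down and the split edges bottom-up, separating each element from its
-- predecessors by a subsemigroup.  Maximality of F gives F = G.

open import Defs
open import Level using (0ℓ)
open import Data.Nat using (ℕ; zero; suc; _<_; _≤_; _+_; s≤s; z≤n; _<?_)
open import Data.Nat.Properties
  using (<-≤-trans; ≤-trans; ≤-refl; m≤m+n; +-monoʳ-<; +-monoʳ-≤; +-comm; <-irrefl; <-asym; <-trans; ≮⇒≥; <⇒≤; <-cmp)
open import Data.Nat.Properties using (≤-pred; suc-injective)
open import Data.Fin using (Fin; _≟_) renaming (zero to fzero)
open import Data.Product using (Σ; _×_; _,_; proj₁; proj₂; ∃-syntax)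
open import Data.Sum using (_⊎_; inj₁; inj₂; map₂; swap) renaming (map to map⊎)
open import Data.Empty using (⊥; ⊥-elim)
open import Data.Unit using (⊤; tt)
open import Data.List using (List; []; _∷_; _++_; [_]; take; length; filter; map; allFin; cartesianProductWith)
open import Data.List.Membership.Propositional using (_∈_; _∉_; lose)
open import Data.List.Membership.Propositional.Properties
  using (∈-++⁻; ∈-++⁺ˡ; ∈-++⁺ʳ; ∈-filter⁺; ∈-filter⁻; ∈-map⁺; ∈-map⁻; ∈-allFin)
open import Data.List.Membership.Propositional.Properties using (∈-cartesianProductWith⁺; ∈-cartesianProductWith⁻)
open import Data.List.Properties using (filter-notAll; ++-assoc; ++-identityʳ; length-++; length-++-≤ˡ)
open import Data.List.Relation.Unary.Any using (Any; here; there)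
import Data.List.Relation.Unary.All as All
import Data.List.Relation.Unary.All.Properties as All++
open import Data.List.Relation.Unary.AllPairs using (_∷_; [])
open import Data.List.Relation.Unary.Unique.Propositional using (Unique)
import Data.List.Relation.Unary.Unique.Propositional.Properties as Unique
open import Data.List.Relation.Unary.Linked using (Linked; []; [-]; _∷_)
open import Relation.Nullary using (¬_; yes; no; Dec)
open import Relation.Nullary.Decidable using (_⊎-dec_; _×-dec_; ¬?; decidable-stable)
open import Relation.Unary using (Decidable)
open import Relation.Binary using (Rel; Tri; tri<; tri≈; tri>)
open import Relation.Binary.PropositionalEquality using (_≡_; _≢_; refl; sym; trans; cong; subst; isEquivalence)
open import Relation.Binary.Construct.Closure.ReflexiveTransitive using (Star; ε; _◅_; _◅◅_)
import Relation.Binary.Construct.Closure.ReflexiveTransitive as Star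
open import Function.Bundles using (_⇔_; mk⇔; Equivalence)

module _ {n : ℕ} where

  pr·pr : (i j l : Fin n) → pr i j · pr j l ≡ pr i l
  pr·pr i j l with j ≟ j
  ... | yes _ = refl
  ... | no j≢j = ⊥-elim (j≢j refl)

  pr·pr-cases : (i j k l : Fin n) → (j ≡ k × pr i j · pr k l ≡ pr i l) ⊎ pr i j · pr k l ≡ 𝟘
  pr·pr-cases i j k l with j ≟ k
  ... | yes j≡k = inj₁ (j≡k , refl)
  ... | no _ = inj₂ refl

  pr-injective : {a b c d : Fin n} → pr a b ≡ pr c d → a ≡ c × b ≡ d
  pr-injective refl = refl , refl

  Closed : Subset n → Set
  Closed Q = ∀ x y → Q x → Q y → Q (x · y)

  -- Since every product is 0 or a composite (i,j)(j,l) = (i,l), a set is a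
  -- subsemigroup as soon as it contains 0 and is closed under composing pairs.
  closed-by-pairs : (S : Subset n) → S 𝟘 → (∀ i j l → S (pr i j) → S (pr j l) → S (pr i l)) → Closed S
  closed-by-pairs S s𝟘 comp 𝟘 y _ _ = s𝟘
  closed-by-pairs S s𝟘 comp (pr i j) 𝟘 _ _ = s𝟘
  closed-by-pairs S s𝟘 comp (pr i j) (pr k l) sx sy with pr·pr-cases i j k l
  ... | inj₁ (refl , e) = subst S (sym e) (comp i j l sx sy)
  ... | inj₂ e = subst S (sym e) s𝟘

  Gen-closed : {X : Subset n} → Closed (Gen X)
  Gen-closed _ _ = mul

  Gen-least : {X Q : Subset n} → X ⊆ Q → Closed Q → Gen X ⊆ Q
  Gen-least X⊆Q closed x (base p) = X⊆Q x p
  Gen-least X⊆Q closed _ (mul {x} {y} g h) = closed x y (Gen-least X⊆Q closed x g) (Gen-least X⊆Q closed y h)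

  Gen-mono : {X Y : Subset n} → X ⊆ Y → Gen X ⊆ Gen Y
  Gen-mono X⊆Y = Gen-least (λ x p → base (X⊆Y x p)) Gen-closed

  separated : {X Q : Subset n} {x : B n} → Closed Q → X ⊆ Q → ¬ Q x → ¬ Gen X x
  separated closed X⊆Q x∉Q g = x∉Q (Gen-least X⊆Q closed _ g)

  ∅ : Subset n
  ∅ _ = ⊥

  infixl 25 _∪_ _∪｛_｝

  _∪_ : Subset n → Subset n → Subset n
  (P ∪ Q) x = P x ⊎ Q x

  _∪｛_｝ : Subset n → B n → Subset n
  (P ∪｛ x ｝) y = P y ⊎ y ≡ x

  ∪｛｝-mono : {P P' : Subset n} {x : B n} → P' ⊆ P → P' ∪｛ x ｝ ⊆ P ∪｛ x ｝
  ∪｛｝-mono P'⊆P y (inj₁ p) = inj₁ (P'⊆P y p)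
  ∪｛｝-mono P'⊆P y (inj₂ e) = inj₂ e

  module _ {P : Subset n} {x : B n} where

    shift : (ys : List (B n)) → P ∪ ⟦ x ∷ ys ⟧ ⊆ (P ∪｛ x ｝) ∪ ⟦ ys ⟧
    shift ys z (inj₁ p) = inj₁ (inj₁ p)
    shift ys z (inj₂ (here r)) = inj₁ (inj₂ r)
    shift ys z (inj₂ (there m)) = inj₂ m

    unshift : (ys : List (B n)) → (P ∪｛ x ｝) ∪ ⟦ ys ⟧ ⊆ P ∪ ⟦ x ∷ ys ⟧
    unshift ys z (inj₁ (inj₁ p)) = inj₁ p
    unshift ys z (inj₁ (inj₂ r)) = inj₂ (here r)
    unshift ys z (inj₂ m) = inj₂ (there m)

  Indep : Subset n → List (B n) → Set
  Indep P [] = ⊤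
  Indep P (x ∷ xs) = ¬ Gen P x × Indep (P ∪｛ x ｝) xs

  Indep-anti : {P P' : Subset n} (xs : List (B n)) → P' ⊆ P → Indep P xs → Indep P' xs
  Indep-anti [] _ _ = tt
  Indep-anti (x ∷ xs) P'⊆P (new , rest) =
    (λ g → new (Gen-mono P'⊆P x g)) ,
    Indep-anti xs (∪｛｝-mono P'⊆P) rest

  Indep-++ : {P : Subset n} (as bs : List (B n)) → Indep P as → Indep (P ∪ ⟦ as ⟧) bs → Indep P (as ++ bs)
  Indep-++ [] bs _ ind = Indep-anti bs (λ _ → inj₁) ind
  Indep-++ (a ∷ as) bs (new , ind-as) ind-bs = new , Indep-++ as bs ind-as (Indep-anti bs (unshift as) ind-bs)

  Indep-outside : {P : Subset n} (xs : List (B n)) → Indep P xs → ∀ y → y ∈ xs → ¬ P y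
  Indep-outside (x ∷ xs) (new , _) y (here refl) p = new (base p)
  Indep-outside (x ∷ xs) (_ , rest) y (there m) p = Indep-outside xs rest y m (inj₁ p)

  Indep-unique : {P : Subset n} (xs : List (B n)) → Indep P xs → Unique xs
  Indep-unique [] _ = []
  Indep-unique (x ∷ xs) (_ , rest) =
    All.tabulate (λ {y} m x≡y → Indep-outside xs rest y m (inj₂ (sym x≡y))) ∷ Indep-unique xs rest

  Indep-filter : {P P' : Subset n} {Q : B n → Set} (Q? : Decidable Q) (xs : List (B n)) →
                 P' ⊆ P → Indep P xs → Indep P' (filter Q? xs)
  Indep-filter Q? [] _ _ = tt
  Indep-filter Q? (x ∷ xs) P'⊆P (new , rest) with Q? x
  ... | yes _ = (λ g → new (Gen-mono P'⊆P x g)) ,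
                Indep-filter Q? xs (∪｛｝-mono P'⊆P) rest
  ... | no _ = Indep-filter Q? xs (λ y p → inj₁ (P'⊆P y p)) rest

  record LastSplit (P : Subset n) (xs : List (B n)) : Set where
    field
      last : B n
      others : List (B n)
      last∈ : last ∈ xs
      covers : ∀ y → y ∈ xs → y ≡ last ⊎ y ∈ others
      last-new : ¬ Gen (P ∪ ⟦ others ⟧) last

  Indep-last : (P : Subset n) (e : B n) (es : List (B n)) → Indep P (e ∷ es) → LastSplit P (e ∷ es)
  Indep-last P e [] (new , _) = record
    { last = e ; others = [] ; last∈ = here refl ; covers = λ { y (here r) → inj₁ r }
    ; last-new = λ g → new (Gen-mono (λ { z (inj₁ p) → p ; z (inj₂ ()) }) e g) }
  Indep-last P e (e' ∷ es) (_ , rest) = record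
    { last = last ; others = e ∷ others ; last∈ = there last∈
    ; covers = λ { y (here r) → inj₂ (here r) ; y (there m) → map₂ there (covers y m) }
    ; last-new = λ g → last-new (Gen-mono (shift others) last g) }
    where
    open LastSplit (Indep-last (P ∪｛ e ｝) e' es rest)

  Indep-separated : (R C P : Subset n) (ys : List (B n)) → Unique ys →
                    (∀ y → y ∈ ys → C y × ¬ R y × Closed (λ z → R z ⊎ (C z × z ≢ y))) →
                    P ⊆ (λ z → R z ⊎ (C z × z ∉ ys)) → Indep P ys
  Indep-separated R C P [] _ _ _ = tt
  Indep-separated R C P (y ∷ ys) (y∉ys ∷ uys) sep P⊆ =
    separated closed P⊆R∪C-y y∉ ,
    Indep-separated R C _ ys uys (λ z m → sep z (there m)) P+y⊆
    where
    y∈C = proj₁ (sep y (here refl))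
    y∉R = proj₁ (proj₂ (sep y (here refl)))
    closed = proj₂ (proj₂ (sep y (here refl)))
    P⊆R∪C-y : P ⊆ (λ z → R z ⊎ (C z × z ≢ y))
    P⊆R∪C-y z pz with P⊆ z pz
    ... | inj₁ r = inj₁ r
    ... | inj₂ (c , z∉) = inj₂ (c , λ e → z∉ (here e))
    y∉ : ¬ (R y ⊎ (C y × y ≢ y))
    y∉ (inj₁ r) = y∉R r
    y∉ (inj₂ (_ , y≢y)) = y≢y refl
    P+y⊆ : (P ∪｛ y ｝) ⊆ (λ z → R z ⊎ (C z × z ∉ ys))
    P+y⊆ z (inj₁ pz) with P⊆ z pz
    ... | inj₁ r = inj₁ r
    ... | inj₂ (c , z∉) = inj₂ (c , λ m → z∉ (there m))
    P+y⊆ z (inj₂ refl) = inj₂ (y∈C , λ m → All.lookup y∉ys m refl)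

  ChainOver : Subset n → List (B n) → Set
  ChainOver P xs = ∀ i → i < length xs → ¬ (Gen (P ∪ ⟦ take (suc i) xs ⟧) ⊆ Gen (P ∪ ⟦ take i xs ⟧))

  chain⇒Indep : (P : Subset n) (xs : List (B n)) → ChainOver P xs → Indep P xs
  chain⇒Indep P [] _ = tt
  chain⇒Indep P (x ∷ xs) chain = x-new , chain⇒Indep (P ∪｛ x ｝) xs chain'
    where
    x-new : ¬ Gen P x
    x-new g = chain 0 (s≤s z≤n) (Gen-least x-generated Gen-closed)
      where
      x-generated : P ∪ ⟦ [ x ] ⟧ ⊆ Gen (P ∪ ⟦ [] ⟧)
      x-generated y (inj₁ p) = base (inj₁ p)
      x-generated y (inj₂ (here refl)) = Gen-mono (λ _ → inj₁) x g
    chain' : ChainOver (P ∪｛ x ｝) xs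
    chain' i i< incl = chain (suc i) (s≤s i<)
      (λ y g → Gen-mono (unshift _) y (incl y (Gen-mono (shift _) y g)))

  Indep⇒chain : (P : Subset n) (xs : List (B n)) → Indep P xs → ChainOver P xs
  Indep⇒chain P (x ∷ xs) (x-new , _) zero _ incl =
    x-new (Gen-mono (λ { y (inj₁ p) → p ; y (inj₂ ()) }) x (incl x (base (inj₂ (here refl)))))
  Indep⇒chain P (x ∷ xs) (_ , rest) (suc i) (s≤s i<) incl =
    Indep⇒chain (P ∪｛ x ｝) xs rest i i< (λ y g → Gen-mono (shift _) y (incl y (Gen-mono (unshift _) y g)))

  take-⊆ : (ys : List (B n)) (i : ℕ) → ⟦ take i ys ⟧ ⊆ ⟦ take (suc i) ys ⟧
  take-⊆ (y ∷ ys) (suc i) x (here e) = here e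
  take-⊆ (y ∷ ys) (suc i) x (there m) = there (take-⊆ ys i x m)

  strictChain⇔Indep : (xs : List (B n)) → StrictChain xs ⇔ Indep ∅ xs
  strictChain⇔Indep xs = mk⇔
    (λ sc → chain⇒Indep ∅ xs λ i i< incl →
              proj₂ (sc i i<) (λ y g → Gen-mono without-∅ y (incl y (Gen-mono (λ _ → inj₂) y g))))
    (λ ind i i< → Gen-mono (take-⊆ xs i) ,
                  λ incl → Indep⇒chain ∅ xs ind i i< (λ y g → Gen-mono (λ _ → inj₂) y (incl y (Gen-mono without-∅ y g))))
    where
    without-∅ : {X : Subset n} → ∅ ∪ X ⊆ X
    without-∅ y (inj₂ m) = m

  -- The recursion on es (a path
  -- through the first pair (a,b) is a path to a, then (a,b), then a path from b)
  -- makes reachability decidable.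

  Reach : List (B n) → Fin n → Fin n → Set
  Reach [] u v = ⊥
  Reach (𝟘 ∷ es) u v = Reach es u v
  Reach (pr a b ∷ es) u v = Reach es u v ⊎ ((u ≡ a ⊎ Reach es u a) × (b ≡ v ⊎ Reach es b v))

  Reach? : (es : List (B n)) (u v : Fin n) → Dec (Reach es u v)
  Reach? [] u v = no (λ ())
  Reach? (𝟘 ∷ es) u v = Reach? es u v
  Reach? (pr a b ∷ es) u v = Reach? es u v ⊎-dec ((u ≟ a ⊎-dec Reach? es u a) ×-dec (b ≟ v ⊎-dec Reach? es b v))

  Reach-weaken : (x : B n) (es : List (B n)) {u v : Fin n} → Reach es u v → Reach (x ∷ es) u v
  Reach-weaken 𝟘 es r = r
  Reach-weaken (pr a b) es r = inj₁ r

  Reach-step : (es : List (B n)) {u v : Fin n} → pr u v ∈ es → Reach es u v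
  Reach-step (pr a b ∷ es) (here refl) = inj₂ (inj₁ refl , inj₁ refl)
  Reach-step (x ∷ es) (there m) = Reach-weaken x es (Reach-step es m)

  Reach-trans : (es : List (B n)) {u v w : Fin n} → Reach es u v → Reach es v w → Reach es u w
  Reach-trans (𝟘 ∷ es) r s = Reach-trans es r s
  Reach-trans (pr a b ∷ es) (inj₁ r) (inj₁ s) = inj₁ (Reach-trans es r s)
  Reach-trans (pr a b ∷ es) (inj₁ r) (inj₂ (inj₁ refl , bw)) = inj₂ (inj₂ r , bw)
  Reach-trans (pr a b ∷ es) (inj₁ r) (inj₂ (inj₂ va , bw)) = inj₂ (inj₂ (Reach-trans es r va) , bw)
  Reach-trans (pr a b ∷ es) (inj₂ (ua , inj₁ refl)) (inj₁ s) = inj₂ (ua , inj₂ s)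
  Reach-trans (pr a b ∷ es) (inj₂ (ua , inj₂ bv)) (inj₁ s) = inj₂ (ua , inj₂ (Reach-trans es bv s))
  Reach-trans (pr a b ∷ es) (inj₂ (ua , _)) (inj₂ (_ , bw)) = inj₂ (ua , bw)

  Reach-generated : (es : List (B n)) {u v : Fin n} → Reach es u v → Gen ⟦ es ⟧ (pr u v)
  Reach-generated (𝟘 ∷ es) r = Gen-mono (λ _ → there) _ (Reach-generated es r)
  Reach-generated (pr a b ∷ es) (inj₁ r) = Gen-mono (λ _ → there) _ (Reach-generated es r)
  Reach-generated (pr a b ∷ es) {u} {v} (inj₂ (ua , bv)) = to-v (to-b ua) bv
    where
    G = Gen ⟦ pr a b ∷ es ⟧
    earlier : {c d : Fin n} → Reach es c d → G (pr c d)
    earlier r = Gen-mono (λ _ → there) _ (Reach-generated es r)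
    to-b : u ≡ a ⊎ Reach es u a → G (pr u b)
    to-b (inj₁ refl) = base (here refl)
    to-b (inj₂ r) = subst G (pr·pr u a b) (mul (earlier r) (base (here refl)))
    to-v : G (pr u b) → b ≡ v ⊎ Reach es b v → G (pr u v)
    to-v g (inj₁ refl) = g
    to-v g (inj₂ r) = subst G (pr·pr u b v) (mul g (earlier r))

-- The node  node t₁ t₂ p q  has the
-- vertices of t₁ (its left part) followed by those of t₂ (its right part), and
-- the split edge (p,q) leads from the right part (p ∈ t₂) back to the left part
-- (q ∈ t₁).
data CutTree (n : ℕ) : Set where
  leaf : Fin n → CutTree n
  node : CutTree n → CutTree n → Fin n → Fin n → CutTree n

module _ {n : ℕ} where

  open import Data.List.Membership.DecPropositional (_≟_ {n}) using (_∈?_)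

  -- the vertices in in-order; this order will be the linear order L
  verts : CutTree n → List (Fin n)
  verts (leaf v) = [ v ]
  verts (node t₁ t₂ p q) = verts t₁ ++ verts t₂

  splitEdges : CutTree n → List (B n)
  splitEdges (leaf v) = []
  splitEdges (node t₁ t₂ p q) = splitEdges t₁ ++ (splitEdges t₂ ++ [ pr p q ])

  splitEdge-root : (t₁ t₂ : CutTree n) (p q : Fin n) → pr p q ∈ splitEdges (node t₁ t₂ p q)
  splitEdge-root t₁ t₂ p q = ∈-++⁺ʳ (splitEdges t₁) (∈-++⁺ʳ (splitEdges t₂) (here refl))

  Forward : CutTree n → Fin n → Fin n → Set
  Forward (leaf _) a b = ⊥
  Forward (node t₁ t₂ _ _) a b = (a ∈ verts t₁ × b ∈ verts t₂) ⊎ (Forward t₁ a b ⊎ Forward t₂ a b)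

  crossings : CutTree n → CutTree n → List (B n)
  crossings t₁ t₂ = cartesianProductWith pr (verts t₁) (verts t₂)

  forwardPairs : CutTree n → List (B n)
  forwardPairs (leaf _) = []
  forwardPairs (node t₁ t₂ _ _) = crossings t₁ t₂ ++ (forwardPairs t₁ ++ forwardPairs t₂)

  verts-nonempty : (t : CutTree n) → 1 ≤ length (verts t)
  verts-nonempty (leaf _) = s≤s z≤n
  verts-nonempty (node t₁ t₂ _ _) = ≤-trans (verts-nonempty t₁) (length-++-≤ˡ (verts t₁))

  WellFormed : CutTree n → Set
  WellFormed (leaf _) = ⊤
  WellFormed (node t₁ t₂ p q) = q ∈ verts t₁ × p ∈ verts t₂ × WellFormed t₁ × WellFormed t₂

  Forward-verts : (t : CutTree n) {a b : Fin n} → Forward t a b → a ∈ verts t × b ∈ verts t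
  Forward-verts (node t₁ t₂ _ _) (inj₁ (a∈ , b∈)) = ∈-++⁺ˡ a∈ , ∈-++⁺ʳ (verts t₁) b∈
  Forward-verts (node t₁ t₂ _ _) (inj₂ (inj₁ f)) = let (a∈ , b∈) = Forward-verts t₁ f in ∈-++⁺ˡ a∈ , ∈-++⁺ˡ b∈
  Forward-verts (node t₁ t₂ _ _) (inj₂ (inj₂ f)) =
    let (a∈ , b∈) = Forward-verts t₂ f in ∈-++⁺ʳ (verts t₁) a∈ , ∈-++⁺ʳ (verts t₁) b∈

  forwardPairs-sound : (t : CutTree n) {x : B n} → x ∈ forwardPairs t → ∃[ a ] ∃[ b ] (x ≡ pr a b × Forward t a b)
  forwardPairs-sound (node t₁ t₂ _ _) m with ∈-++⁻ (crossings t₁ t₂) m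
  ... | inj₁ m' =
    let (a , b , a∈ , b∈ , e) = ∈-cartesianProductWith⁻ pr (verts t₁) (verts t₂) m' in a , b , e , inj₁ (a∈ , b∈)
  ... | inj₂ m' with ∈-++⁻ (forwardPairs t₁) m'
  ...   | inj₁ m₁ = let (a , b , e , f) = forwardPairs-sound t₁ m₁ in a , b , e , inj₂ (inj₁ f)
  ...   | inj₂ m₂ = let (a , b , e , f) = forwardPairs-sound t₂ m₂ in a , b , e , inj₂ (inj₂ f)

  forwardPairs-complete : (t : CutTree n) {a b : Fin n} → Forward t a b → pr a b ∈ forwardPairs t
  forwardPairs-complete (node t₁ t₂ _ _) (inj₁ (a∈ , b∈)) = ∈-++⁺ˡ (∈-cartesianProductWith⁺ pr a∈ b∈)
  forwardPairs-complete (node t₁ t₂ _ _) (inj₂ (inj₁ f)) =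
    ∈-++⁺ʳ (crossings t₁ t₂) (∈-++⁺ˡ (forwardPairs-complete t₁ f))
  forwardPairs-complete (node t₁ t₂ _ _) (inj₂ (inj₂ f)) =
    ∈-++⁺ʳ (crossings t₁ t₂) (∈-++⁺ʳ (forwardPairs t₁) (forwardPairs-complete t₂ f))

  splitEdge-backward : (t : CutTree n) {x : B n} → WellFormed t → x ∈ splitEdges t →
                       ∃[ u ] ∃[ w ] (x ≡ pr u w × Forward t w u)
  splitEdge-backward (node t₁ t₂ p q) (q∈ , p∈ , wf₁ , wf₂) m with ∈-++⁻ (splitEdges t₁) m
  ... | inj₁ m₁ = let (u , w , e , f) = splitEdge-backward t₁ wf₁ m₁ in u , w , e , inj₂ (inj₁ f)
  ... | inj₂ m' with ∈-++⁻ (splitEdges t₂) m'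
  ...   | inj₁ m₂ = let (u , w , e , f) = splitEdge-backward t₂ wf₂ m₂ in u , w , e , inj₂ (inj₂ f)
  ...   | inj₂ (here e) = p , q , e , inj₁ (q∈ , p∈)

  Inside : List (Fin n) → B n → Set
  Inside V 𝟘 = ⊥
  Inside V (pr a b) = a ≢ b × a ∈ V × b ∈ V

  Inside? : (V : List (Fin n)) → Decidable (Inside V)
  Inside? V 𝟘 = no (λ ())
  Inside? V (pr a b) = ¬? (a ≟ b) ×-dec (a ∈? V ×-dec b ∈? V)

  module Construction (xs : List (B n)) (ind : Indep ∅ xs) where

    Accounts : CutTree n → Set
    Accounts t = ∀ a b → pr a b ∈ xs → a ≢ b → a ∈ verts t → b ∈ verts t → Forward t a b ⊎ pr a b ∈ splitEdges t

    record CutTreeOn (V : List (Fin n)) : Set where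
      field
        tree : CutTree n
        verts⊆ : ∀ w → w ∈ verts tree → w ∈ V
        ⊆verts : ∀ w → w ∈ V → w ∈ verts tree
        unique : Unique (verts tree)
        wellFormed : WellFormed tree
        accounts : Accounts tree

    record Split (V : List (Fin n)) : Set₁ where
      field
        Right : Fin n → Set
        Right? : Decidable Right
        p q : Fin n
        p∈V : p ∈ V
        q∈V : q ∈ V
        p-right : Right p
        q-left : ¬ Right q
        only-back : ∀ a b → pr a b ∈ xs → a ≢ b → a ∈ V → b ∈ V → Right a → ¬ Right b → a ≡ p × b ≡ q

      Left? : Decidable (λ u → ¬ Right u)
      Left? u = ¬? (Right? u)

    -- Splitting, given the list es of pairs of xs inside V (in the order of xs).
    -- Without such pairs any split works.  Otherwise let (p,q) be the last of them
    -- and the right part everything reachable from p by the earlier ones: q is not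
    -- reachable, since (p,q) is not generated by the earlier pairs.
    splitWith : (V : List (Fin n)) (v w : Fin n) → v ∈ V → w ∈ V → v ≢ w → (es : List (B n)) →
                (∀ y → y ∈ xs → Inside V y → y ∈ es) → (∀ y → y ∈ es → Inside V y) → Indep ∅ es → Split V
    splitWith V v w v∈ w∈ v≢w [] complete _ _ = record
      { Right = λ u → u ≢ v ; Right? = λ u → ¬? (u ≟ v) ; p = w ; q = v ; p∈V = w∈ ; q∈V = v∈
      ; p-right = λ w≡v → v≢w (sym w≡v) ; q-left = λ v≢v → v≢v refl
      ; only-back = λ a b m a≢b a∈ b∈ _ _ → ⊥-elim (nothing-in-[] (complete (pr a b) m (a≢b , a∈ , b∈))) }
      where
      nothing-in-[] : {y : B n} → y ∉ []
      nothing-in-[] ()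
    splitWith V v w v∈ w∈ v≢w (e ∷ es) complete sound indep =
      fromLast last (sound last last∈) covers last-new
      where
      open LastSplit (Indep-last ∅ e es indep)
      fromLast : (x : B n) → Inside V x → (∀ y → y ∈ e ∷ es → y ≡ x ⊎ y ∈ others) →
                 ¬ Gen (∅ ∪ ⟦ others ⟧) x → Split V
      fromLast (pr p₀ q₀) (p₀≢q₀ , p₀∈ , q₀∈) covers' new = record
        { Right = Right ; Right? = λ u → (p₀ ≟ u) ⊎-dec Reach? others p₀ u
        ; p = p₀ ; q = q₀ ; p∈V = p₀∈ ; q∈V = q₀∈ ; p-right = inj₁ refl
        ; q-left = q-left ; only-back = only-back }
        where
        Right : Fin n → Set
        Right u = p₀ ≡ u ⊎ Reach others p₀ u
        q-left : ¬ Right q₀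
        q-left (inj₁ p₀≡q₀) = p₀≢q₀ p₀≡q₀
        q-left (inj₂ r) = new (Gen-mono (λ _ → inj₂) _ (Reach-generated others r))
        only-back : ∀ a b → pr a b ∈ xs → a ≢ b → a ∈ V → b ∈ V → Right a → ¬ Right b → a ≡ p₀ × b ≡ q₀
        only-back a b m a≢b a∈ b∈ a-right b-left with covers' (pr a b) (complete (pr a b) m (a≢b , a∈ , b∈))
        ... | inj₁ refl = refl , refl
        ... | inj₂ earlier with a-right
        ...   | inj₁ refl = ⊥-elim (b-left (inj₂ (Reach-step others earlier)))
        ...   | inj₂ r = ⊥-elim (b-left (inj₂ (Reach-trans others r (Reach-step others earlier))))

    split : (v w : Fin n) (ws : List (Fin n)) → Unique (v ∷ w ∷ ws) → Split (v ∷ w ∷ ws)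
    split v w ws (v∉ ∷ _) =
      splitWith V v w (here refl) (there (here refl)) (All.lookup v∉ (here refl)) (filter (Inside? V) xs)
        (λ y m i → ∈-filter⁺ (Inside? V) m i) (λ y m → proj₂ (∈-filter⁻ (Inside? V) {xs = xs} m))
        (Indep-filter (Inside? V) xs (λ _ ()) ind)
      where
      V = v ∷ w ∷ ws

    node-accounts : (tₗ tᵣ : CutTree n) (p q : Fin n) → Accounts tₗ → Accounts tᵣ →
                    (∀ a b → pr a b ∈ xs → a ≢ b → a ∈ verts tᵣ → b ∈ verts tₗ → a ≡ p × b ≡ q) →
                    Accounts (node tₗ tᵣ p q)
    node-accounts tₗ tᵣ p q accₗ accᵣ back a b m a≢b a∈ b∈ with ∈-++⁻ (verts tₗ) a∈ | ∈-++⁻ (verts tₗ) b∈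
    ... | inj₁ aₗ | inj₂ bᵣ = inj₁ (inj₁ (aₗ , bᵣ))
    ... | inj₂ aᵣ | inj₁ bₗ with back a b m a≢b aᵣ bₗ
    ...   | refl , refl = inj₂ (splitEdge-root tₗ tᵣ p q)
    node-accounts tₗ tᵣ p q accₗ accᵣ back a b m a≢b a∈ b∈ | inj₁ aₗ | inj₁ bₗ with accₗ a b m a≢b aₗ bₗ
    ...   | inj₁ f = inj₁ (inj₂ (inj₁ f))
    ...   | inj₂ e = inj₂ (∈-++⁺ˡ e)
    node-accounts tₗ tᵣ p q accₗ accᵣ back a b m a≢b a∈ b∈ | inj₂ aᵣ | inj₂ bᵣ with accᵣ a b m a≢b aᵣ bᵣ
    ...   | inj₁ f = inj₁ (inj₂ (inj₂ f))
    ...   | inj₂ e = inj₂ (∈-++⁺ʳ (splitEdges tₗ) (∈-++⁺ˡ e))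

    join : {V : List (Fin n)} (s : Split V) → CutTreeOn (filter (Split.Left? s) V) →
           CutTreeOn (filter (Split.Right? s) V) → CutTreeOn V
    join {V} s left right = record
      { tree = node tₗ tᵣ p q ; verts⊆ = verts⊆ ; ⊆verts = ⊆verts
      ; unique = Unique.++⁺ L.unique R.unique (λ (m₁ , m₂) → proj₂ (in-left m₁) (proj₂ (in-right m₂)))
      ; wellFormed = q∈tₗ , p∈tᵣ , L.wellFormed , R.wellFormed
      ; accounts = node-accounts tₗ tᵣ p q L.accounts R.accounts λ a b m a≢b aᵣ bₗ →
          only-back a b m a≢b (proj₁ (in-right aᵣ)) (proj₁ (in-left bₗ)) (proj₂ (in-right aᵣ)) (proj₂ (in-left bₗ)) }
      where
      open Split s
      module L = CutTreeOn left
      module R = CutTreeOn right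
      tₗ = L.tree
      tᵣ = R.tree
      in-left : ∀ {u} → u ∈ verts tₗ → u ∈ V × ¬ Right u
      in-left m = ∈-filter⁻ Left? (L.verts⊆ _ m)
      in-right : ∀ {u} → u ∈ verts tᵣ → u ∈ V × Right u
      in-right m = ∈-filter⁻ Right? (R.verts⊆ _ m)
      q∈tₗ : q ∈ verts tₗ
      q∈tₗ = L.⊆verts q (∈-filter⁺ Left? q∈V q-left)
      p∈tᵣ : p ∈ verts tᵣ
      p∈tᵣ = R.⊆verts p (∈-filter⁺ Right? p∈V p-right)
      verts⊆ : ∀ u → u ∈ verts tₗ ++ verts tᵣ → u ∈ V
      verts⊆ u m with ∈-++⁻ (verts tₗ) m
      ... | inj₁ mₗ = proj₁ (in-left mₗ)
      ... | inj₂ mᵣ = proj₁ (in-right mᵣ)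
      ⊆verts : ∀ u → u ∈ V → u ∈ verts tₗ ++ verts tᵣ
      ⊆verts u m with Right? u
      ... | yes r = ∈-++⁺ʳ (verts tₗ) (R.⊆verts u (∈-filter⁺ Right? m r))
      ... | no l = ∈-++⁺ˡ (L.⊆verts u (∈-filter⁺ Left? m l))

    build : (k : ℕ) (V : List (Fin n)) → length V ≤ k → Unique V → (u : Fin n) → u ∈ V → CutTreeOn V
    build k (v ∷ []) _ _ _ _ = record
      { tree = leaf v ; verts⊆ = λ _ m → m ; ⊆verts = λ _ m → m ; unique = All.[] ∷ [] ; wellFormed = tt
      ; accounts = λ { a b _ a≢b (here refl) (here refl) → ⊥-elim (a≢b refl) } }
    build (suc k) (v ∷ w ∷ ws) (s≤s len≤) uV _ _ =
      join s (build k (filter Left? V) (shorter Left? (lose p∈V (λ l → l p-right))) (Unique.filter⁺ Left? uV)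
                    q (∈-filter⁺ Left? q∈V q-left))
             (build k (filter Right? V) (shorter Right? (lose q∈V q-left)) (Unique.filter⁺ Right? uV)
                    p (∈-filter⁺ Right? p∈V p-right))
      where
      V = v ∷ w ∷ ws
      s = split v w ws uV
      open Split s
      -- each part misses a vertex of V
      shorter : {P : Fin n → Set} (P? : Decidable P) → Any (λ u → ¬ P u) V →
                length (filter P? V) ≤ k
      shorter P? missing = ≤-pred (<-≤-trans (filter-notAll P? V missing) (s≤s len≤))

  -- the position of v in a list (its length if v does not occur)
  position : Fin n → List (Fin n) → ℕ
  position v [] = 0
  position v (x ∷ xs) with v ≟ x
  ... | yes _ = 0
  ... | no _ = suc (position v xs)

  position-++ˡ : (v : Fin n) (xs ys : List (Fin n)) → v ∈ xs → position v (xs ++ ys) ≡ position v xs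
  position-++ˡ v (x ∷ xs) ys m with v ≟ x | m
  ... | yes _ | _ = refl
  ... | no v≢x | here v≡x = ⊥-elim (v≢x v≡x)
  ... | no _ | there m' = cong suc (position-++ˡ v xs ys m')

  position-++ʳ : (v : Fin n) (xs ys : List (Fin n)) → v ∉ xs → position v (xs ++ ys) ≡ length xs + position v ys
  position-++ʳ v [] ys _ = refl
  position-++ʳ v (x ∷ xs) ys v∉ with v ≟ x
  ... | yes v≡x = ⊥-elim (v∉ (here v≡x))
  ... | no _ = cong suc (position-++ʳ v xs ys (λ m → v∉ (there m)))

  position-< : (v : Fin n) (xs : List (Fin n)) → v ∈ xs → position v xs < length xs
  position-< v (x ∷ xs) m with v ≟ x | m
  ... | yes _ | _ = s≤s z≤n
  ... | no v≢x | here v≡x = ⊥-elim (v≢x v≡x)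
  ... | no _ | there m' = s≤s (position-< v xs m')

  position-injective : (v w : Fin n) (xs : List (Fin n)) → v ∈ xs → w ∈ xs → position v xs ≡ position w xs → v ≡ w
  position-injective v w (x ∷ xs) v∈ w∈ e with v ≟ x | w ≟ x | v∈ | w∈ | e
  ... | yes v≡x | yes w≡x | _ | _ | _ = trans v≡x (sym w≡x)
  ... | no v≢x | _ | here v≡x | _ | _ = ⊥-elim (v≢x v≡x)
  ... | _ | no w≢x | _ | here w≡x | _ = ⊥-elim (w≢x w≡x)
  ... | no _ | no _ | there v∈' | there w∈' | e' = position-injective v w xs v∈' w∈' (suc-injective e')

  disjoint-++ : (xs : List (Fin n)) {ys : List (Fin n)} {v : Fin n} → Unique (xs ++ ys) → v ∈ xs → v ∉ ys
  disjoint-++ (x ∷ xs) (x∉ ∷ _) (here refl) m = All.lookup x∉ (∈-++⁺ʳ xs m) refl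
  disjoint-++ (x ∷ xs) (_ ∷ u) (there v∈) m = disjoint-++ xs u v∈ m

  unique-++ˡ : (xs : List (Fin n)) {ys : List (Fin n)} → Unique (xs ++ ys) → Unique xs
  unique-++ˡ [] u = []
  unique-++ˡ (x ∷ xs) (x∉ ∷ u) = All.tabulate (λ m → All.lookup x∉ (∈-++⁺ˡ m)) ∷ unique-++ˡ xs u

  unique-++ʳ : (xs : List (Fin n)) {ys : List (Fin n)} → Unique (xs ++ ys) → Unique ys
  unique-++ʳ [] u = u
  unique-++ʳ (x ∷ xs) (_ ∷ u) = unique-++ʳ xs u

  position-segment : (X M Y : List (Fin n)) (v : Fin n) → Unique (X ++ (M ++ Y)) → v ∈ M →
                     length X ≤ position v (X ++ (M ++ Y)) × position v (X ++ (M ++ Y)) < length X + length M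
  position-segment X M Y v u m
    rewrite position-++ʳ v X (M ++ Y) (λ v∈X → disjoint-++ X u v∈X (∈-++⁺ˡ m)) | position-++ˡ v M Y m =
    m≤m+n _ _ , +-monoʳ-< (length X) (position-< v M m)

  position-prefix : (X Z : List (Fin n)) (v : Fin n) → v ∈ X → position v (X ++ Z) < length X
  position-prefix X Z v m rewrite position-++ˡ v X Z m = position-< v X m

  position-suffix : (X Z : List (Fin n)) (v : Fin n) → Unique (X ++ Z) → v ∈ Z → length X ≤ position v (X ++ Z)
  position-suffix X Z v u m rewrite position-++ʳ v X Z (λ v∈X → disjoint-++ X u v∈X m) = m≤m+n _ _

  module InOrder (order : List (Fin n)) (uniq : Unique order) where

    rank : Fin n → ℕ
    rank v = position v order

    record Segment (t : CutTree n) (X Y : List (Fin n)) : Set where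
      constructor segment
      field splits : order ≡ X ++ (verts t ++ Y)

    rank-segment : {t : CutTree n} {X Y : List (Fin n)} {v : Fin n} → Segment t X Y → v ∈ verts t →
                   length X ≤ rank v × rank v < length X + length (verts t)
    rank-segment {t} {X} {Y} {v} (segment refl) m = position-segment X (verts t) Y v uniq m

    rank-prefix : {X Z : List (Fin n)} {v : Fin n} → order ≡ X ++ Z → v ∈ X → rank v < length X
    rank-prefix {X} {Z} {v} refl m = position-prefix X Z v m

    rank-suffix : {X Z : List (Fin n)} {v : Fin n} → order ≡ X ++ Z → v ∈ Z → length X ≤ rank v
    rank-suffix {X} {Z} {v} refl m = position-suffix X Z v uniq m

    module _ {t₁ t₂ : CutTree n} {p q : Fin n} {X Y : List (Fin n)} (seg : Segment (node t₁ t₂ p q) X Y) where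

      segment-left : Segment t₁ X (verts t₂ ++ Y)
      segment-left = segment (trans (Segment.splits seg) (cong (X ++_) (++-assoc (verts t₁) (verts t₂) Y)))

      segment-right : Segment t₂ (X ++ verts t₁) Y
      segment-right = segment (trans (Segment.splits segment-left) (sym (++-assoc X (verts t₁) (verts t₂ ++ Y))))

      cut-left : {v : Fin n} → v ∈ verts t₁ → rank v < length X + length (verts t₁)
      cut-left m = proj₂ (rank-segment segment-left m)

      cut-right : {v : Fin n} → v ∈ verts t₂ → length X + length (verts t₁) ≤ rank v
      cut-right {v} m = subst (_≤ rank v) (length-++ X {verts t₁}) (proj₁ (rank-segment segment-right m))

    Forward-rank : (t : CutTree n) {X Y : List (Fin n)} {a b : Fin n} → Segment t X Y → Forward t a b → rank a < rank b
    Forward-rank (node t₁ t₂ p q) seg (inj₁ (a∈ , b∈)) = <-≤-trans (cut-left seg a∈) (cut-right seg b∈)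
    Forward-rank (node t₁ t₂ p q) seg (inj₂ (inj₁ f)) = Forward-rank t₁ (segment-left seg) f
    Forward-rank (node t₁ t₂ p q) seg (inj₂ (inj₂ f)) = Forward-rank t₂ (segment-right seg) f

    Forward-complete : (t : CutTree n) {X Y : List (Fin n)} {a b : Fin n} → Segment t X Y →
                       a ∈ verts t → b ∈ verts t → rank a < rank b → Forward t a b
    Forward-complete (leaf v) seg (here refl) (here refl) a<b = ⊥-elim (<-irrefl refl a<b)
    Forward-complete (node t₁ t₂ p q) seg a∈ b∈ a<b with ∈-++⁻ (verts t₁) a∈ | ∈-++⁻ (verts t₁) b∈
    ... | inj₁ a₁ | inj₁ b₁ = inj₂ (inj₁ (Forward-complete t₁ (segment-left seg) a₁ b₁ a<b))
    ... | inj₂ a₂ | inj₂ b₂ = inj₂ (inj₂ (Forward-complete t₂ (segment-right seg) a₂ b₂ a<b))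
    ... | inj₁ a₁ | inj₂ b₂ = inj₁ (a₁ , b₂)
    ... | inj₂ a₂ | inj₁ b₁ = ⊥-elim (<-asym a<b (<-≤-trans (cut-left seg b₁) (cut-right seg a₂)))

  IsZero : B n → Set
  IsZero 𝟘 = ⊤
  IsZero (pr _ _) = ⊥

  IsLoop : B n → Set
  IsLoop 𝟘 = ⊥
  IsLoop (pr u w) = u ≡ w

  loops : List (Fin n) → List (B n)
  loops vs = map (λ v → pr v v) vs

  -- Removing one loop from {0} ∪ {loops} leaves a subsemigroup, since a product
  -- of two loops is 0 or the loop itself.
  loops-indep : (vs : List (Fin n)) → Unique vs → (P : Subset n) → P ⊆ IsZero → Indep P (loops vs)
  loops-indep vs uvs P P⊆0 =
    Indep-separated IsZero IsLoop P (loops vs) (Unique.map⁺ (λ e → proj₁ (pr-injective e)) uvs) separating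
      (λ z p → inj₁ (P⊆0 z p))
    where
    separating : ∀ y → y ∈ loops vs → IsLoop y × ¬ IsZero y × Closed (λ z → IsZero z ⊎ (IsLoop z × z ≢ y))
    separating y m with ∈-map⁻ (λ v → pr v v) m
    ... | v , _ , refl = refl , (λ ()) , closed-by-pairs _ (inj₁ tt) compose
      where
      S : B n → Set
      S z = IsZero z ⊎ (IsLoop z × z ≢ pr v v)
      compose : ∀ i j l → S (pr i j) → S (pr j l) → S (pr i l)
      compose i j l (inj₂ (refl , _)) jl = jl

  module Independence (order : List (Fin n)) (uniq : Unique order) (complete : ∀ v → v ∈ order) where

    open InOrder order uniq

    segment-unique : (t : CutTree n) {X Y : List (Fin n)} → Segment t X Y → Unique (verts t)
    segment-unique t {X} (segment e) = unique-++ˡ (verts t) (unique-++ʳ X (subst Unique e uniq))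

    segment-contiguous : (t : CutTree n) {X Y : List (Fin n)} {u w m : Fin n} → Segment t X Y →
                         u ∈ verts t → w ∈ verts t → m ∉ verts t → rank u < rank m → rank m < rank w → ⊥
    segment-contiguous t {X} {Y} {m = m} seg@(segment e) u∈ w∈ m∉ u<m m<w with ∈-++⁻ X (subst (m ∈_) e (complete m))
    ... | inj₁ m∈X = <-asym u<m (<-≤-trans (rank-prefix e m∈X) (proj₁ (rank-segment seg u∈)))
    ... | inj₂ m∈ with ∈-++⁻ (verts t) m∈
    ...   | inj₁ m∈t = m∉ m∈t
    ...   | inj₂ m∈Y = <-asym m<w (<-≤-trans (proj₂ (rank-segment seg w∈))
              (subst (_≤ rank m) (length-++ X) (rank-suffix (trans e (sym (++-assoc X (verts t) Y))) m∈Y)))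

    AscendingOutside : CutTree n → B n → Set
    AscendingOutside t 𝟘 = ⊤
    AscendingOutside t (pr u w) = u ≡ w ⊎ (rank u < rank w × ¬ (u ∈ verts t × w ∈ verts t))

    Crossing : CutTree n → CutTree n → B n → Set
    Crossing t₁ t₂ 𝟘 = ⊥
    Crossing t₁ t₂ (pr a b) = a ∈ verts t₁ × b ∈ verts t₂

    AscendingOutside-left : (t₁ t₂ : CutTree n) (p q : Fin n) → AscendingOutside (node t₁ t₂ p q) ⊆ AscendingOutside t₁
    AscendingOutside-left t₁ t₂ p q 𝟘 _ = tt
    AscendingOutside-left t₁ t₂ p q (pr u w) (inj₁ e) = inj₁ e
    AscendingOutside-left t₁ t₂ p q (pr u w) (inj₂ (u<w , out)) =
      inj₂ (u<w , λ (u∈ , w∈) → out (∈-++⁺ˡ u∈ , ∈-++⁺ˡ w∈))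

    AscendingOutside-right : (t₁ t₂ : CutTree n) (p q : Fin n) → AscendingOutside (node t₁ t₂ p q) ⊆ AscendingOutside t₂
    AscendingOutside-right t₁ t₂ p q 𝟘 _ = tt
    AscendingOutside-right t₁ t₂ p q (pr u w) (inj₁ e) = inj₁ e
    AscendingOutside-right t₁ t₂ p q (pr u w) (inj₂ (u<w , out)) =
      inj₂ (u<w , λ (u∈ , w∈) → out (∈-++⁺ʳ (verts t₁) u∈ , ∈-++⁺ʳ (verts t₁) w∈))

    module _ {t₁ t₂ : CutTree n} {p q : Fin n} {X Y : List (Fin n)} (seg : Segment (node t₁ t₂ p q) X Y) where

      private
        t = node t₁ t₂ p q
        ut = segment-unique t seg
        crossing-< : ∀ {a b} → a ∈ verts t₁ → b ∈ verts t₂ → rank a < rank b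
        crossing-< a∈ b∈ = Forward-rank t seg (inj₁ (a∈ , b∈))

      crossing-outside : {x : B n} → x ∈ crossings t₁ t₂ → AscendingOutside t₁ x × AscendingOutside t₂ x
      crossing-outside m with ∈-cartesianProductWith⁻ pr (verts t₁) (verts t₂) m
      ... | a , b , a∈ , b∈ , refl =
        inj₂ (crossing-< a∈ b∈ , λ (_ , b∈₁) → disjoint-++ (verts t₁) ut b∈₁ b∈) ,
        inj₂ (crossing-< a∈ b∈ , λ (a∈₂ , _) → disjoint-++ (verts t₁) ut a∈ a∈₂)

      -- Removing one crossing pair y from the ascending pairs outside the node
      -- and its crossing pairs leaves a subsemigroup: a composite of two such
      -- pairs lying within the node would have to leave the node and come back.
      crossing-separated : (y : B n) → Closed (λ z → AscendingOutside t z ⊎ (Crossing t₁ t₂ z × z ≢ y))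
      crossing-separated y = closed-by-pairs _ (inj₁ tt) compose
        where
        S : B n → Set
        S z = AscendingOutside t z ⊎ (Crossing t₁ t₂ z × z ≢ y)
        compose : ∀ i j l → S (pr i j) → S (pr j l) → S (pr i l)
        compose i j l (inj₁ (inj₁ refl)) jl = jl
        compose i j l ij (inj₁ (inj₁ refl)) = ij
        compose i j l (inj₁ (inj₂ (i<j , out₁))) (inj₁ (inj₂ (j<l , out₂))) = inj₁ (inj₂ (<-trans i<j j<l , out))
          where
          out : ¬ (i ∈ verts t × l ∈ verts t)
          out (i∈ , l∈) with j ∈? verts t
          ... | yes j∈ = out₁ (i∈ , j∈)
          ... | no j∉ = segment-contiguous t seg i∈ l∈ j∉ i<j j<l
        compose i j l (inj₁ (inj₂ (i<j , out))) (inj₂ ((j∈ , l∈) , _)) =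
          inj₁ (inj₂ (<-trans i<j (crossing-< j∈ l∈) , λ (i∈ , _) → out (i∈ , ∈-++⁺ˡ j∈)))
        compose i j l (inj₂ ((i∈ , j∈) , _)) (inj₁ (inj₂ (j<l , out))) =
          inj₁ (inj₂ (<-trans (crossing-< i∈ j∈) j<l , λ (_ , l∈) → out (∈-++⁺ʳ (verts t₁) j∈ , l∈)))
        compose i j l (inj₂ ((_ , j∈₂) , _)) (inj₂ ((j∈₁ , _) , _)) = ⊥-elim (disjoint-++ (verts t₁) ut j∈₁ j∈₂)

      crossings-indep : (P : Subset n) → P ⊆ AscendingOutside t → Indep P (crossings t₁ t₂)
      crossings-indep P P⊆ =
        Indep-separated (AscendingOutside t) (Crossing t₁ t₂) P (crossings t₁ t₂)
          (Unique.cartesianProductWith⁺ pr pr-injective (unique-++ˡ (verts t₁) ut) (unique-++ʳ (verts t₁) ut))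
          separating (λ z pz → inj₁ (P⊆ z pz))
        where
        separating : ∀ y → y ∈ crossings t₁ t₂ → Crossing t₁ t₂ y × ¬ AscendingOutside t y ×
                     Closed (λ z → AscendingOutside t z ⊎ (Crossing t₁ t₂ z × z ≢ y))
        separating y m with ∈-cartesianProductWith⁻ pr (verts t₁) (verts t₂) m
        ... | a , b , a∈ , b∈ , refl = (a∈ , b∈) , inside , crossing-separated (pr a b)
          where
          inside : ¬ AscendingOutside t (pr a b)
          inside (inj₁ refl) = disjoint-++ (verts t₁) ut a∈ b∈
          inside (inj₂ (_ , out)) = out (∈-++⁺ˡ a∈ , ∈-++⁺ʳ (verts t₁) b∈)

    forwardPairs-indep : (t : CutTree n) {X Y : List (Fin n)} → Segment t X Y → (P : Subset n) →
                         P ⊆ AscendingOutside t → Indep P (forwardPairs t)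
    forwardPairs-indep (leaf _) _ _ _ = tt
    forwardPairs-indep (node t₁ t₂ p q) seg P P⊆ =
      Indep-++ (crossings t₁ t₂) (forwardPairs t₁ ++ forwardPairs t₂) (crossings-indep seg P P⊆)
        (Indep-++ (forwardPairs t₁) (forwardPairs t₂)
          (forwardPairs-indep t₁ (segment-left seg) _ before-left)
          (forwardPairs-indep t₂ (segment-right seg) _ before-right))
      where
      before-left : P ∪ ⟦ crossings t₁ t₂ ⟧ ⊆ AscendingOutside t₁
      before-left z (inj₁ pz) = AscendingOutside-left t₁ t₂ p q z (P⊆ z pz)
      before-left z (inj₂ m) = proj₁ (crossing-outside seg m)
      -- the forward pairs of t₁ lie within t₁, hence not within t₂
      before-right : P ∪ ⟦ crossings t₁ t₂ ⟧ ∪ ⟦ forwardPairs t₁ ⟧ ⊆ AscendingOutside t₂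
      before-right z (inj₁ (inj₁ pz)) = AscendingOutside-right t₁ t₂ p q z (P⊆ z pz)
      before-right z (inj₁ (inj₂ m)) = proj₂ (crossing-outside seg m)
      before-right z (inj₂ m) with forwardPairs-sound t₁ m
      ... | a , b , refl , f =
        inj₂ (Forward-rank t₁ (segment-left seg) f ,
              λ (a∈₂ , _) → disjoint-++ (verts t₁) (segment-unique _ seg) (proj₁ (Forward-verts t₁ f)) a∈₂)

    NotBackAcross : ℕ → B n → Set
    NotBackAcross c 𝟘 = ⊤
    NotBackAcross c (pr u w) = ¬ (rank w < c × c ≤ rank u)

    -- such pairs form a subsemigroup: a composite crossing the cut backwards has a
    -- factor doing so
    NotBackAcross-closed : (c : ℕ) → Closed (NotBackAcross c)
    NotBackAcross-closed c = closed-by-pairs (NotBackAcross c) tt compose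
      where
      compose : ∀ i j l → NotBackAcross c (pr i j) → NotBackAcross c (pr j l) → NotBackAcross c (pr i l)
      compose i j l ij jl (l<c , c≤i) with rank j <? c
      ... | yes j<c = ij (j<c , c≤i)
      ... | no j≮c = jl (l<c , ≮⇒≥ j≮c)

    RespectsCuts : CutTree n → ℕ → B n → Set
    RespectsCuts (leaf _) o x = ⊤
    RespectsCuts (node t₁ t₂ _ _) o x =
      NotBackAcross (o + length (verts t₁)) x × RespectsCuts t₁ o x × RespectsCuts t₂ (o + length (verts t₁)) x

    RespectsCuts-𝟘 : (t : CutTree n) (o : ℕ) → RespectsCuts t o 𝟘
    RespectsCuts-𝟘 (leaf _) o = tt
    RespectsCuts-𝟘 (node t₁ t₂ _ _) o = tt , RespectsCuts-𝟘 t₁ o , RespectsCuts-𝟘 t₂ _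

    RespectsCuts-ascending : (t : CutTree n) (o : ℕ) (u w : Fin n) → rank u ≤ rank w → RespectsCuts t o (pr u w)
    RespectsCuts-ascending (leaf _) o u w u≤w = tt
    RespectsCuts-ascending (node t₁ t₂ _ _) o u w u≤w =
      (λ (w<c , c≤u) → <-irrefl refl (<-≤-trans w<c (≤-trans c≤u u≤w))) ,
      RespectsCuts-ascending t₁ o u w u≤w , RespectsCuts-ascending t₂ _ u w u≤w

    RespectsCuts-before : (t : CutTree n) (o : ℕ) (u w : Fin n) → rank u ≤ o → RespectsCuts t o (pr u w)
    RespectsCuts-before (leaf _) o u w u≤o = tt
    RespectsCuts-before (node t₁ t₂ _ _) o u w u≤o =
      (λ (_ , c≤u) → <-irrefl refl (<-≤-trans o<c (≤-trans c≤u u≤o))) ,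
      RespectsCuts-before t₁ o u w u≤o , RespectsCuts-before t₂ _ u w (≤-trans u≤o (m≤m+n _ _))
      where
      o<c : o < o + length (verts t₁)
      o<c = subst (_≤ o + length (verts t₁)) (+-comm o 1) (+-monoʳ-≤ o (verts-nonempty t₁))

    -- The split edges of t, listed bottom-up, are independent over any set of
    -- elements respecting the cuts of t: the split edge of a node is the only
    -- element so far leading backwards across the cut of that node.
    splitEdges-indep : (t : CutTree n) {X Y : List (Fin n)} → Segment t X Y → WellFormed t → (P : Subset n) →
                       P ⊆ RespectsCuts t (length X) → Indep P (splitEdges t)
    splitEdges-indep (leaf _) _ _ _ _ = tt
    splitEdges-indep (node t₁ t₂ p q) {X} seg (q∈ , p∈ , wf₁ , wf₂) P P⊆ =
      Indep-++ (splitEdges t₁) (splitEdges t₂ ++ [ pr p q ])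
        (splitEdges-indep t₁ (segment-left seg) wf₁ P (λ z r → proj₁ (proj₂ (P⊆ z r))))
        (Indep-++ (splitEdges t₂) [ pr p q ]
          (splitEdges-indep t₂ (segment-right seg) wf₂ _ before-right)
          (separated (NotBackAcross-closed c) before-root (λ h → h (cut-left seg q∈ , cut-right seg p∈)) , tt))
      where
      c = length X + length (verts t₁)
      left-edge : ∀ {z} → z ∈ splitEdges t₁ → ∃[ u ] ∃[ w ] (z ≡ pr u w × rank w < c × rank u < c)
      left-edge m with splitEdge-backward t₁ wf₁ m
      ... | u , w , refl , f = let (w∈ , u∈) = Forward-verts t₁ f in u , w , refl , cut-left seg w∈ , cut-left seg u∈
      right-edge : ∀ {z} → z ∈ splitEdges t₂ → ∃[ u ] ∃[ w ] (z ≡ pr u w × c ≤ rank w)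
      right-edge m with splitEdge-backward t₂ wf₂ m
      ... | u , w , refl , f = u , w , refl , cut-right seg (proj₁ (Forward-verts t₂ f))
      before-right : P ∪ ⟦ splitEdges t₁ ⟧ ⊆ RespectsCuts t₂ (length (X ++ verts t₁))
      before-right z h = subst (λ o → RespectsCuts t₂ o z) (sym (length-++ X)) (respects h)
        where
        respects : P z ⊎ z ∈ splitEdges t₁ → RespectsCuts t₂ c z
        respects (inj₁ pz) = proj₂ (proj₂ (P⊆ z pz))
        respects (inj₂ m) with left-edge m
        ... | u , w , refl , _ , u<c = RespectsCuts-before t₂ c u w (<⇒≤ u<c)
      before-root : P ∪ ⟦ splitEdges t₁ ⟧ ∪ ⟦ splitEdges t₂ ⟧ ⊆ NotBackAcross c
      before-root z (inj₁ (inj₁ pz)) = proj₁ (P⊆ z pz)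
      before-root z (inj₁ (inj₂ m)) with left-edge m
      ... | u , w , refl , _ , u<c = λ (_ , c≤u) → <-irrefl refl (<-≤-trans u<c c≤u)
      before-root z (inj₂ m) with right-edge m
      ... | u , w , refl , c≤w = λ (w<c , _) → <-irrefl refl (<-≤-trans w<c c≤w)

  Edges : List (B n) → Rel (Fin n) 0ℓ
  Edges es u w = pr u w ∈ es ⊎ pr w u ∈ es

  node-edge : (t₁ t₂ : CutTree n) (p q : Fin n) {u w : Fin n} → WellFormed (node t₁ t₂ p q) →
              pr u w ∈ splitEdges (node t₁ t₂ p q) →
              (u ∈ verts t₁ × w ∈ verts t₁ × pr u w ∈ splitEdges t₁) ⊎
              (u ∈ verts t₂ × w ∈ verts t₂ × pr u w ∈ splitEdges t₂) ⊎ (u ≡ p × w ≡ q)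
  node-edge t₁ t₂ p q (_ , _ , wf₁ , wf₂) m with ∈-++⁻ (splitEdges t₁) m
  ... | inj₁ m₁ with splitEdge-backward t₁ wf₁ m₁
  ...   | _ , _ , refl , f = inj₁ (proj₂ (Forward-verts t₁ f) , proj₁ (Forward-verts t₁ f) , m₁)
  node-edge t₁ t₂ p q (_ , _ , wf₁ , wf₂) m | inj₂ m' with ∈-++⁻ (splitEdges t₂) m'
  ... | inj₁ m₂ with splitEdge-backward t₂ wf₂ m₂
  ...   | _ , _ , refl , f = inj₂ (inj₁ (proj₂ (Forward-verts t₂ f) , proj₁ (Forward-verts t₂ f) , m₂))
  node-edge t₁ t₂ p q _ m | inj₂ m' | inj₂ (here refl) = inj₂ (inj₂ (refl , refl))

  paths-left : (t₁ t₂ : CutTree n) (p q : Fin n) {u w : Fin n} →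
               Star (Edges (splitEdges t₁)) u w → Star (Edges (splitEdges (node t₁ t₂ p q))) u w
  paths-left t₁ t₂ p q = Star.map (map⊎ ∈-++⁺ˡ ∈-++⁺ˡ)

  paths-right : (t₁ t₂ : CutTree n) (p q : Fin n) {u w : Fin n} →
                Star (Edges (splitEdges t₂)) u w → Star (Edges (splitEdges (node t₁ t₂ p q))) u w
  paths-right t₁ t₂ p q = Star.map (map⊎ in-right in-right)
    where
    in-right : ∀ {x} → x ∈ splitEdges t₂ → x ∈ splitEdges (node t₁ t₂ p q)
    in-right m = ∈-++⁺ʳ (splitEdges t₁) (∈-++⁺ˡ m)

  connected : (t : CutTree n) → WellFormed t → ∀ u w → u ∈ verts t → w ∈ verts t → Star (Edges (splitEdges t)) u w
  connected (leaf v) _ u w (here refl) (here refl) = ε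
  connected (node t₁ t₂ p q) (q∈ , p∈ , wf₁ , wf₂) u w u∈ w∈ with ∈-++⁻ (verts t₁) u∈ | ∈-++⁻ (verts t₁) w∈
  ... | inj₁ u₁ | inj₁ w₁ = paths-left t₁ t₂ p q (connected t₁ wf₁ u w u₁ w₁)
  ... | inj₂ u₂ | inj₂ w₂ = paths-right t₁ t₂ p q (connected t₂ wf₂ u w u₂ w₂)
  ... | inj₁ u₁ | inj₂ w₂ =
    paths-left t₁ t₂ p q (connected t₁ wf₁ u q u₁ q∈) ◅◅
    (inj₂ (splitEdge-root t₁ t₂ p q) ◅ paths-right t₁ t₂ p q (connected t₂ wf₂ p w p∈ w₂))
  ... | inj₂ u₂ | inj₁ w₁ =
    paths-right t₁ t₂ p q (connected t₂ wf₂ u p u₂ p∈) ◅◅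
    (inj₁ (splitEdge-root t₁ t₂ p q) ◅ paths-left t₁ t₂ p q (connected t₁ wf₁ q w q∈ w₁))

  -- Let S be a decidable set of vertices such that the
  -- only R-edges between S and its complement are x → y (leaving S) and y → x
  -- (entering S).  A cycle of distinct vertices through a vertex of S would have
  -- to use the bridge twice, so it stays inside S.

  endpoint : Fin n → List (Fin n) → Fin n
  endpoint a [] = a
  endpoint a (b ∷ bs) = endpoint b bs

  endpoint-∈ : (a : Fin n) (bs : List (Fin n)) → endpoint a bs ∈ a ∷ bs
  endpoint-∈ a [] = here refl
  endpoint-∈ a (b ∷ bs) = there (endpoint-∈ b bs)

  linked-snoc⁻ : {R : Rel (Fin n) 0ℓ} (a : Fin n) (as : List (Fin n)) (b : Fin n) →
                 Linked R (a ∷ as ++ [ b ]) → Linked R (a ∷ as) × R (endpoint a as) b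
  linked-snoc⁻ a [] b (r ∷ _) = [-] , r
  linked-snoc⁻ a (c ∷ cs) b (r ∷ l) = let (l' , r') = linked-snoc⁻ c cs b l in r ∷ l' , r'

  linked-restrict : {R R' : Rel (Fin n) 0ℓ} {S : Fin n → Set} (l : List (Fin n)) → Linked R l → All.All S l →
                    (∀ u w → R u w → S u → S w → R' u w) → Linked R' l
  linked-restrict [] [] _ _ = []
  linked-restrict (a ∷ []) [-] _ _ = [-]
  linked-restrict (a ∷ b ∷ l) (r ∷ rs) (sa All.∷ sb All.∷ ss) f = f a b r sa sb ∷ linked-restrict (b ∷ l) rs (sb All.∷ ss) f

  module Bridge (R : Rel (Fin n) 0ℓ) (S : Fin n → Set) (S? : Decidable S) (x y : Fin n)
                (leaving : ∀ u w → R u w → S u → ¬ S w → u ≡ x × w ≡ y)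
                (entering : ∀ u w → R u w → ¬ S u → S w → u ≡ y × w ≡ x) where

    enters-at-x : ∀ a as → Linked R (a ∷ as) → ¬ S a → S (endpoint a as) → x ∈ as
    enters-at-x a [] _ a∉ a∈ = ⊥-elim (a∉ a∈)
    enters-at-x a (b ∷ bs) (r ∷ l) a∉ end∈ with S? b
    ... | yes b∈ = here (sym (proj₂ (entering a b r a∉ b∈)))
    ... | no b∉ = there (enters-at-x b bs l b∉ end∈)

    leaves-at-x : ∀ a as → Linked R (a ∷ as) → S a → ¬ S (endpoint a as) → x ∈ a ∷ as
    leaves-at-x a [] _ a∈ a∉ = ⊥-elim (a∉ a∈)
    leaves-at-x a (b ∷ bs) (r ∷ l) a∈ end∉ with S? b
    ... | yes b∈ = there (leaves-at-x b bs l b∈ end∉)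
    ... | no b∉ = here (sym (proj₁ (leaving a b r a∈ b∉)))

    path-stays : ∀ a as → Linked R (a ∷ as) → Unique (a ∷ as) → S a → S (endpoint a as) → All.All S (a ∷ as)
    path-stays a [] _ _ a∈ _ = a∈ All.∷ All.[]
    path-stays a (b ∷ bs) (r ∷ l) (a∉bs ∷ ubs) a∈ end∈ with S? b
    ... | yes b∈ = a∈ All.∷ path-stays b bs l ubs b∈ end∈
    ... | no b∉ with leaving a b r a∈ b∉
    ...   | refl , _ = ⊥-elim (All.lookup a∉bs (there (enters-at-x b bs l b∉ end∈)) refl)

    leaves-from-x : ∀ as → Linked R (x ∷ as) → Unique (x ∷ as) → S x → ¬ S (endpoint x as) →
                    Σ (List (Fin n)) λ bs → as ≡ y ∷ bs
    leaves-from-x [] _ _ x∈ end∉ = ⊥-elim (end∉ x∈)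
    leaves-from-x (b ∷ bs) (r ∷ l) (x∉ ∷ _) x∈ end∉ with S? b
    ... | no b∉ = bs , cong (_∷ bs) (proj₂ (leaving x b r x∈ b∉))
    ... | yes b∈ = ⊥-elim (All.lookup x∉ (leaves-at-x b bs l b∈ end∉) refl)

    -- a cycle through v₀ ∈ S lies in S: if its closing step enters S, the cycle
    -- starts x, y, … and also ends in y
    cycle-stays : ∀ v₀ rest → S v₀ → 2 ≤ length rest → Unique (v₀ ∷ rest) → Linked R (v₀ ∷ rest ++ [ v₀ ]) →
                  All.All S (v₀ ∷ rest)
    cycle-stays v₀ rest v₀∈ long u l with linked-snoc⁻ v₀ rest v₀ l
    ... | path , closing with S? (endpoint v₀ rest)
    ...   | yes end∈ = path-stays v₀ rest path u v₀∈ end∈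
    ...   | no end∉ with entering _ _ closing end∉ v₀∈
    ...     | end≡y , refl with leaves-from-x rest path u v₀∈ end∉
    ...       | bs , refl = ⊥-elim (y-twice bs long u end≡y)
      where
      -- y follows x and ends the cycle, so it occurs twice
      y-twice : ∀ bs → 2 ≤ length (y ∷ bs) → Unique (x ∷ y ∷ bs) → endpoint x (y ∷ bs) ≡ y → ⊥
      y-twice [] (s≤s ()) _ _
      y-twice (b ∷ bs') _ (_ ∷ y∉ ∷ _) e = All.lookup y∉ (subst (_∈ b ∷ bs') e (endpoint-∈ b bs')) refl

  module NodeEdges (t₁ t₂ : CutTree n) (p q : Fin n) (wf : WellFormed (node t₁ t₂ p q))
                   (ut : Unique (verts t₁ ++ verts t₂)) where

    T = Edges (splitEdges (node t₁ t₂ p q))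

    disjoint : ∀ {v} → v ∈ verts t₁ → v ∉ verts t₂
    disjoint = disjoint-++ (verts t₁) ut

    p∈t₂ : p ∈ verts t₂
    p∈t₂ = proj₁ (proj₂ wf)

    exits-left : ∀ a b → T a b → a ∈ verts t₁ → b ∉ verts t₁ → a ≡ q × b ≡ p
    exits-left a b (inj₁ m) a∈ b∉ with node-edge t₁ t₂ p q wf m
    ... | inj₁ (_ , b∈ , _) = ⊥-elim (b∉ b∈)
    ... | inj₂ (inj₁ (a∈₂ , _ , _)) = ⊥-elim (disjoint a∈ a∈₂)
    ... | inj₂ (inj₂ (refl , refl)) = ⊥-elim (disjoint a∈ p∈t₂)
    exits-left a b (inj₂ m) a∈ b∉ with node-edge t₁ t₂ p q wf m
    ... | inj₁ (b∈ , _ , _) = ⊥-elim (b∉ b∈)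
    ... | inj₂ (inj₁ (_ , a∈₂ , _)) = ⊥-elim (disjoint a∈ a∈₂)
    ... | inj₂ (inj₂ (refl , refl)) = refl , refl

    enters-left : ∀ a b → T a b → a ∉ verts t₁ → b ∈ verts t₁ → a ≡ p × b ≡ q
    enters-left a b r a∉ b∈ with exits-left b a (swap r) b∈ a∉
    ... | refl , refl = refl , refl

    within-left : ∀ a b → T a b → a ∈ verts t₁ → b ∈ verts t₁ → Edges (splitEdges t₁) a b
    within-left a b (inj₁ m) a∈ b∈ with node-edge t₁ t₂ p q wf m
    ... | inj₁ (_ , _ , m₁) = inj₁ m₁
    ... | inj₂ (inj₁ (a∈₂ , _ , _)) = ⊥-elim (disjoint a∈ a∈₂)
    ... | inj₂ (inj₂ (refl , refl)) = ⊥-elim (disjoint a∈ p∈t₂)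
    within-left a b (inj₂ m) a∈ b∈ with node-edge t₁ t₂ p q wf m
    ... | inj₁ (_ , _ , m₁) = inj₂ m₁
    ... | inj₂ (inj₁ (b∈₂ , _ , _)) = ⊥-elim (disjoint b∈ b∈₂)
    ... | inj₂ (inj₂ (refl , refl)) = ⊥-elim (disjoint b∈ p∈t₂)

    within-right : ∀ a b → T a b → a ∉ verts t₁ → b ∉ verts t₁ → Edges (splitEdges t₂) a b
    within-right a b (inj₁ m) a∉ b∉ with node-edge t₁ t₂ p q wf m
    ... | inj₁ (a∈ , _ , _) = ⊥-elim (a∉ a∈)
    ... | inj₂ (inj₁ (_ , _ , m₂)) = inj₁ m₂
    ... | inj₂ (inj₂ (refl , refl)) = ⊥-elim (b∉ (proj₁ wf))
    within-right a b (inj₂ m) a∉ b∉ with node-edge t₁ t₂ p q wf m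
    ... | inj₁ (b∈ , _ , _) = ⊥-elim (b∉ b∈)
    ... | inj₂ (inj₁ (_ , _ , m₂)) = inj₂ m₂
    ... | inj₂ (inj₂ (refl , refl)) = ⊥-elim (a∉ (proj₁ wf))

  -- The split edges contain no cycle: the root's split edge is a bridge between
  -- its parts, so a cycle lies in the left part if it meets it and in the right
  -- part otherwise.
  acyclic : (t : CutTree n) → WellFormed t → Unique (verts t) → ¬ HasCycle (Edges (splitEdges t))
  acyclic (leaf v) _ _ (_ , [] , () , _)
  acyclic (leaf v) _ _ (_ , _ ∷ _ , _ , _ , (inj₁ () ∷ _))
  acyclic (leaf v) _ _ (_ , _ ∷ _ , _ , _ , (inj₂ () ∷ _))
  acyclic (node t₁ t₂ p q) wf@(_ , _ , wf₁ , wf₂) ut (v₀ , rest , long , u , l) with v₀ ∈? verts t₁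
  ... | yes v₀∈ = acyclic t₁ wf₁ (unique-++ˡ (verts t₁) ut)
          (v₀ , rest , long , u ,
           linked-restrict (v₀ ∷ rest ++ [ v₀ ]) l (All++.++⁺ inside (v₀∈ All.∷ All.[])) within-left)
    where
    open NodeEdges t₁ t₂ p q wf ut
    open Bridge T (_∈ verts t₁) (_∈? verts t₁) q p exits-left enters-left
    inside = cycle-stays v₀ rest v₀∈ long u l
  ... | no v₀∉ = acyclic t₂ wf₂ (unique-++ʳ (verts t₁) ut)
          (v₀ , rest , long , u ,
           linked-restrict (v₀ ∷ rest ++ [ v₀ ]) l (All++.++⁺ outside (v₀∉ All.∷ All.[])) within-right)
    where
    open NodeEdges t₁ t₂ p q wf ut
    stable : ∀ {v} → ¬ ¬ v ∈ verts t₁ → v ∈ verts t₁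
    stable = decidable-stable (_ ∈? verts t₁)
    open Bridge T (_∉ verts t₁) (λ v → ¬? (v ∈? verts t₁)) p q
      (λ a b r a∉ b∈ → enters-left a b r a∉ (stable b∈)) (λ a b r a∈ b∉ → exits-left a b r (stable a∈) b∉)
    outside = cycle-stays v₀ rest v₀∉ long u l

  module FaceOfCutTree (t : CutTree n) (uniq : Unique (verts t)) (wf : WellFormed t) (spans : ∀ v → v ∈ verts t) where

    open InOrder (verts t) uniq
    open Independence (verts t) uniq spans

    whole : Segment t [] []
    whole = segment (sym (++-identityʳ (verts t)))

    L : Rel (Fin n) 0ℓ
    L a b = rank a < rank b

    T : Rel (Fin n) 0ℓ
    T = Edges (splitEdges t)

    splitEdge-descending : ∀ {u w} → pr u w ∈ splitEdges t → rank w < rank u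
    splitEdge-descending m with splitEdge-backward t wf m
    ... | _ , _ , refl , f = Forward-rank t whole f

    L-strictLinear : IsStrictLinearOrder L
    L-strictLinear = record
      { isStrictPartialOrder = record
        { isEquivalence = isEquivalence
        ; irrefl = λ { refl a<a → <-irrefl refl a<a }
        ; trans = <-trans
        ; <-resp-≈ = (λ { refl lt → lt }) , (λ { refl lt → lt }) }
      ; compare = compare }
      where
      compare : ∀ a b → Tri (L a b) (a ≡ b) (L b a)
      compare a b with <-cmp (rank a) (rank b)
      ... | tri< a<b a≢b a≯b = tri< a<b (λ e → a≢b (cong rank e)) a≯b
      ... | tri≈ a≮b a≡b a≯b = tri≈ a≮b (position-injective a b (verts t) (spans a) (spans b) a≡b) a≯b
      ... | tri> a≮b a≢b a>b = tri> a≮b (λ e → a≢b (cong rank e)) a>b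

    T-spanningTree : IsSpanningTree T
    T-spanningTree =
      (λ _ _ → swap) ,
      (λ { v (inj₁ m) → <-irrefl refl (splitEdge-descending m) ; v (inj₂ m) → <-irrefl refl (splitEdge-descending m) }) ,
      (λ u w → connected t wf u w (spans u) (spans w)) ,
      acyclic t wf uniq

    enumeration : List (B n)
    enumeration = 𝟘 ∷ (loops (verts t) ++ (forwardPairs t ++ splitEdges t))

    enumeration-indep : Indep ∅ enumeration
    enumeration-indep =
      separated {Q = ∅} (λ _ _ ()) (λ _ ()) (λ ()) ,
      Indep-++ (loops (verts t)) (forwardPairs t ++ splitEdges t)
        (loops-indep (verts t) uniq _ (λ { _ (inj₂ refl) → tt }))
        (Indep-++ (forwardPairs t) (splitEdges t)
          (forwardPairs-indep t whole _ ascendingOutside)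
          (splitEdges-indep t whole wf _ respectsCuts))
      where
      ascendingOutside : ∅ ∪｛ 𝟘 ｝ ∪ ⟦ loops (verts t) ⟧ ⊆ AscendingOutside t
      ascendingOutside _ (inj₁ (inj₂ refl)) = tt
      ascendingOutside _ (inj₂ m) with ∈-map⁻ (λ v → pr v v) m
      ... | _ , _ , refl = inj₁ refl
      respectsCuts : ∅ ∪｛ 𝟘 ｝ ∪ ⟦ loops (verts t) ⟧ ∪ ⟦ forwardPairs t ⟧ ⊆ RespectsCuts t 0
      respectsCuts _ (inj₁ (inj₁ (inj₂ refl))) = RespectsCuts-𝟘 t 0
      respectsCuts _ (inj₁ (inj₂ m)) with ∈-map⁻ (λ v → pr v v) m
      ... | v , _ , refl = RespectsCuts-ascending t 0 v v ≤-refl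
      respectsCuts _ (inj₂ m) with forwardPairs-sound t m
      ... | a , b , refl , f = RespectsCuts-ascending t 0 a b (<⇒≤ (Forward-rank t whole f))

    face : IsFace ⟦ enumeration ⟧
    face = enumeration , Indep-unique enumeration enumeration-indep , (λ _ → mk⇔ (λ m → m) (λ m → m)) ,
           Equivalence.from (strictChain⇔Indep enumeration) enumeration-indep

    loop∈ : ∀ v → pr v v ∈ enumeration
    loop∈ v = there (∈-++⁺ˡ (∈-map⁺ (λ v → pr v v) (spans v)))

    forward∈ : ∀ {a b} → Forward t a b → pr a b ∈ enumeration
    forward∈ f = there (∈-++⁺ʳ (loops (verts t)) (∈-++⁺ˡ (forwardPairs-complete t f)))

    splitEdge∈ : ∀ {u w} → pr u w ∈ splitEdges t → pr u w ∈ enumeration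
    splitEdge∈ m = there (∈-++⁺ʳ (loops (verts t)) (∈-++⁺ʳ (forwardPairs t) m))

    enumeration⇔Φ : ∀ x → x ∈ enumeration ⇔ Φ L (Opposite L T) x
    enumeration⇔Φ x = mk⇔ (to x) (from x)
      where
      to : ∀ x → x ∈ enumeration → Φ L (Opposite L T) x
      to x (here refl) = inj₁ refl
      to x (there m) with ∈-++⁻ (loops (verts t)) m
      ... | inj₁ m-loop with ∈-map⁻ (λ v → pr v v) m-loop
      ...   | v , _ , refl = inj₂ (inj₂ (inj₁ (inj₂ (v , refl))))
      to x (there m) | inj₂ m' with ∈-++⁻ (forwardPairs t) m'
      ... | inj₁ m-fwd with forwardPairs-sound t m-fwd
      ...   | a , b , refl , f = inj₂ (inj₁ (a , b , refl , Forward-rank t whole f))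
      to x (there m) | inj₂ m' | inj₂ m-split with splitEdge-backward t wf m-split
      ... | u , w , refl , f = inj₂ (inj₂ (inj₂ (u , w , refl , inj₁ m-split , Forward-rank t whole f)))
      from : ∀ x → Φ L (Opposite L T) x → x ∈ enumeration
      from x (inj₁ refl) = here refl
      from x (inj₂ (inj₁ (a , b , refl , a<b))) = forward∈ (Forward-complete t whole (spans a) (spans b) a<b)
      from x (inj₂ (inj₂ (inj₁ (inj₁ refl)))) = here refl
      from x (inj₂ (inj₂ (inj₁ (inj₂ (v , refl))))) = loop∈ v
      from x (inj₂ (inj₂ (inj₂ (u , w , refl , inj₁ m , _)))) = splitEdge∈ m
      from x (inj₂ (inj₂ (inj₂ (u , w , refl , inj₂ m , u<w)))) = ⊥-elim (<-asym u<w (splitEdge-descending m))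

theorem5p22 : (n : ℕ) → 1 ≤ n → (F : Subset n) → IsFacet F →
    Σ (Rel (Fin n) 0ℓ) λ L → Σ (Rel (Fin n) 0ℓ) λ T →
      IsStrictLinearOrder L × IsSpanningTree T ×
      (∀ x → F x ⇔ Φ L (Opposite L T) x)
theorem5p22 (suc m) _ F ((xs , _ , F⇔xs , chain) , maximal) = L , T , L-strictLinear , T-spanningTree , F⇔Φ
  where
  open Construction xs (Equivalence.to (strictChain⇔Indep xs) chain)
  -- the cut tree on all vertices (there is one since n ≥ 1), built from the enumeration of F
  open CutTreeOn (build _ (allFin (suc m)) ≤-refl (Unique.allFin⁺ (suc m)) fzero (∈-allFin fzero))
  spans : ∀ v → v ∈ verts tree
  spans v = ⊆verts v (∈-allFin v)
  open FaceOfCutTree tree unique wellFormed spans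
  F⊆G : F ⊆ ⟦ enumeration ⟧
  F⊆G 𝟘 _ = here refl
  F⊆G (pr a b) fx with a ≟ b
  ... | yes refl = loop∈ a
  ... | no a≢b with accounts a b (Equivalence.to (F⇔xs (pr a b)) fx) a≢b (spans a) (spans b)
  ...   | inj₁ f = forward∈ f
  ...   | inj₂ m = splitEdge∈ m
  G⊆F : ⟦ enumeration ⟧ ⊆ F
  G⊆F = maximal ⟦ enumeration ⟧ face F⊆G
  F⇔Φ : ∀ x → F x ⇔ Φ L (Opposite L T) x
  F⇔Φ x = mk⇔ (λ fx → Equivalence.to (enumeration⇔Φ x) (F⊆G x fx))
              (λ φ → G⊆F x (Equivalence.from (enumeration⇔Φ x) φ))
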